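{- Given a term $\Delta \vdash t : A$, a substitution $\Gamma \vdash_{\mathrm{s}} s : \Delta$ and a value $\delta : [\![\Delta]\!]_\Gamma$, if $\mathcal{R}_{\Delta,\Gamma}(s,\delta)$ then $\mathcal{R}_{A,\Gamma}(t[s],\ [\![t]\!]\,\delta)$.
   Context: Setting: the Fitch-style modal lambda calculus IKC (for the intuitionistic modal logic IK). Types are $A ::= \iota \mid A \to B \mid \Box A$ ($\iota$ an uninterpreted base type); contexts are $\Gamma ::= \cdot \mid \Gamma, A \mid \Gamma, \text{🔒}$ (🔒 is a "lock"). Order-preserving embeddings (OPEs) $\Gamma \le \Gamma'$ are generated by $\cdot \le \cdot$, drop ($\Gamma\le\Gamma'$ gives $\Gamma \le \Gamma', A$), keep-variable ($\Gamma, A \le \Gamma', A$) and keep-lock ($\Gamma,\text{🔒} \le \Gamma',\text{🔒}$). The IKC modal accessibility relation $\Delta \lhd \Gamma$ holds exactly when $\Gamma = \Delta, \text{🔒}, \Delta'$ with $\Delta'$ lock-free (generated by $\mathrm{nil} : \Gamma \lhd \Gamma,\text{🔒}$ and $e : \Delta\lhd\Gamma$ gives $\Delta \lhd \Gamma, A$). Intrinsically typed terms: De Bruijn variables, $\lambda$, application, $\mathrm{box}$ (from $\Gamma,\text{🔒} \vdash t : A$ get $\Gamma \vdash \mathrm{box}\,t : \Box A$) and $\mathrm{unbox}(t,e)$ (from $\Delta \vdash t : \Box A$ and $e : \Delta \lhd \Gamma$ get $\Gamma \vdash \mathrm{unbox}(t,e) : A$). Substitutions $\Gamma \vdash_{\mathrm{s}}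 s : \Delta$: empty; $(s,t)$ for $\Delta, A$; and $\mathrm{lock}(s,e) : \Delta,\text{🔒}$ from $\Theta \vdash_{\mathrm{s}} s : \Delta$ and $e : \Theta \lhd \Gamma$. $t[s]$ is substitution application, $\mathrm{wk}(o,t)$ is weakening along an OPE $o$. The equational theory $\approx$ consists of the usual $\to$-$\beta$/$\eta$, $\mathrm{unbox}(\mathrm{box}\,t, e) \approx \mathrm{wk}(\mathrm{factor}\,e, t)$ (where $\mathrm{factor} : \Delta\lhd\Gamma \to (\Delta,\text{🔒} \le \Gamma)$) and $t \approx \mathrm{box}(\mathrm{unbox}(t,\mathrm{nil}))$, plus congruences. NbE model: a possible-world model with worlds = contexts, intuitionistic accessibility = OPEs, modal accessibility = $\lhd$, and valuation $V_{\iota,\Gamma}$ = neutral elements $\Gamma \vdash_{\mathrm{ne}} \iota$ (normal forms/neutrals are the standard $\beta\eta$-normal forms, with neutral $\mathrm{unbox}(n,e)$ for neutral $n$). Interpretation: $[\![\iota]\!]_\Gamma = (\Gamma \vdash_{\mathrm{ne}} \iota)$; $[\![A\to B]\!]_\Gamma = \forall \Gamma'.\,\Gamma\le\Gamma' \to [\![A]\!]_{\Gamma'} \to [\![B]\!]_{\Gamma'}$; $[\![\Box A]\!]_\Gamma = \forall\Gamma'.\,\Gamma\le\Gamma' \to \forall\Delta.\,\Gamma'\lhd\Delta \to [\![A]\!]_\Delta$; $[\![\cdot]\!]_w = \top$, $[\![\Gamma,A]\!]_w = [\![\Gamma]\!]_w \times [\![A]\!]_w$, $[\![\Gamma,\text{🔒}]\!]_w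 = \sum_u [\![\Gamma]\!]_u \times (u \lhd w)$. $[\![t]\!] : \forall w.\,[\![\Gamma]\!]_w \to [\![A]\!]_w$ is evaluation of terms. Logical relations $\mathcal{R}_{A,\Gamma} : (\Gamma \vdash A) \to [\![A]\!]_\Gamma \to \mathrm{Type}$: $\mathcal{R}_{\iota,\Gamma}(t,n)$ iff $t \approx n$ (the neutral $n$ viewed as a term); $\mathcal{R}_{A\to B,\Gamma}(t,f) = \forall \Gamma', o : \Gamma\le\Gamma', u, a.\ \mathcal{R}_{A,\Gamma'}(u,a) \to \mathcal{R}_{B,\Gamma'}(\mathrm{app}(\mathrm{wk}(o,t),u),\ f\,o\,a)$; $\mathcal{R}_{\Box A,\Gamma}(t,b) = \forall\Gamma', o : \Gamma\le\Gamma', \Delta, e : \Gamma'\lhd\Delta.\ \mathcal{R}_{A,\Delta}(\mathrm{unbox}(\mathrm{wk}(o,t),e),\ b\,o\,e)$. Extended to substitutions $\mathcal{R}_{\Delta,\Gamma} : (\Gamma\vdash_{\mathrm{s}}\Delta) \to [\![\Delta]\!]_\Gamma \to \mathrm{Type}$: $\mathcal{R}_{\cdot,\Gamma}(\text{empty},()) = \top$; $\mathcal{R}_{\Delta,A;\Gamma}((s,t),(\delta,a)) = \mathcal{R}_{\Delta,\Gamma}(s,\delta)\times\mathcal{R}_{A,\Gamma}(t,a)$; $\mathcal{R}_{\Delta,\text{🔒};\Gamma}(\mathrm{lock}(s, e : \Theta\lhd\Gamma), (\delta,e)) = \mathcal{R}_{\Delta,\Theta}(s,\delta)$. -}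

module Defs where

open import Data.Unit using (⊤; tt)
open import Data.Product using (Σ; _×_; _,_)

infixr 7 _⇒_
data Ty : Set where
  ι   : Ty
  _⇒_ : Ty → Ty → Ty
  □_  : Ty → Ty

infixl 6 _`,_
data Ctx : Set where
  []    : Ctx
  _`,_  : Ctx → Ty → Ctx
  _,🔒  : Ctx → Ctx

variable
  Γ Γ' Γ'' Δ Δ' Θ w w' u : Ctx
  A B : Ty

data _≤_ : Ctx → Ctx → Set where
  base  : [] ≤ []
  drop  : Γ ≤ Γ' → Γ ≤ (Γ' `, A)
  keep  : Γ ≤ Γ' → (Γ `, A) ≤ (Γ' `, A)
  keep🔒 : Γ ≤ Γ' → (Γ ,🔒) ≤ (Γ' ,🔒)

idOPE : ∀ {Γ} → Γ ≤ Γ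
idOPE {[]}     = base
idOPE {Γ `, A} = keep idOPE
idOPE {Γ ,🔒}  = keep🔒 idOPE

_∙_ : Γ ≤ Γ' → Γ' ≤ Γ'' → Γ ≤ Γ''
o ∙ base           = o
o ∙ drop o'        = drop (o ∙ o')
keep o ∙ keep o'   = keep (o ∙ o')
drop o ∙ keep o'   = drop (o ∙ o')
keep🔒 o ∙ keep🔒 o' = keep🔒 (o ∙ o')

-- IKC modal accessibility:  Δ ◁ Γ  iff  Γ = Δ , 🔒 , Δ' with Δ' lock-free
data _◁_ : Ctx → Ctx → Set where
  nil : Γ ◁ (Γ ,🔒)
  ext : Δ ◁ Γ → Δ ◁ (Γ `, A)

factor : Δ ◁ Γ → (Δ ,🔒) ≤ Γ
factor nil     = keep🔒 idOPE
factor (ext e) = drop (factor e)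

◁-wk : Δ ◁ Γ → Γ ≤ Γ' → Σ Ctx (λ Δ' → (Δ ≤ Δ') × (Δ' ◁ Γ'))
◁-wk e (drop o) with ◁-wk e o
... | Δ' , o' , e' = Δ' , o' , ext e'
◁-wk (ext e) (keep o) with ◁-wk e o
... | Δ' , o' , e' = Δ' , o' , ext e'
◁-wk nil (keep🔒 {Γ' = Γ'} o) = Γ' , o , nil

data Var : Ctx → Ty → Set where
  ze : Var (Γ `, A) A
  su : Var Γ A → Var (Γ `, B) A

data Tm : Ctx → Ty → Set where
  var   : Var Γ A → Tm Γ A
  lam   : Tm (Γ `, A) B → Tm Γ (A ⇒ B)
  app   : Tm Γ (A ⇒ B) → Tm Γ A → Tm Γ B
  box   : Tm (Γ ,🔒) A → Tm Γ (□ A)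
  unbox : Tm Δ (□ A) → Δ ◁ Γ → Tm Γ A

wkVar : Γ ≤ Γ' → Var Γ A → Var Γ' A
wkVar (drop o) v      = su (wkVar o v)
wkVar (keep o) ze     = ze
wkVar (keep o) (su v) = su (wkVar o v)

wk : Γ ≤ Γ' → Tm Γ A → Tm Γ' A
wk o (var v)     = var (wkVar o v)
wk o (lam t)     = lam (wk (keep o) t)
wk o (app t u)   = app (wk o t) (wk o u)
wk o (box t)     = box (wk (keep🔒 o) t)
wk o (unbox t e) with ◁-wk e o
... | _ , o' , e' = unbox (wk o' t) e'

data Sub : Ctx → Ctx → Set where
  empty : Sub Γ []
  _,_   : Sub Γ Δ → Tm Γ A → Sub Γ (Δ `, A)
  lock  : Sub Θ Δ → Θ ◁ Γ → Sub Γ (Δ ,🔒)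

wkSub : Γ ≤ Γ' → Sub Γ Δ → Sub Γ' Δ
wkSub o empty      = empty
wkSub o (s , t)    = wkSub o s , wk o t
wkSub o (lock s e) with ◁-wk e o
... | _ , o' , e' = lock (wkSub o' s) e'

idSub : ∀ {Γ} → Sub Γ Γ
idSub {[]}     = empty
idSub {Γ `, A} = wkSub (drop idOPE) idSub , var ze
idSub {Γ ,🔒}  = lock idSub nil

factorSub : Δ' ◁ Δ → Sub Γ Δ → Σ Ctx (λ Γ' → Sub Γ' Δ' × (Γ' ◁ Γ))
factorSub nil     (lock s e) = _ , s , e
factorSub (ext e) (s , t)    = factorSub e s

substVar : Var Δ A → Sub Γ Δ → Tm Γ A
substVar ze     (s , t) = t
substVar (su v) (s , t) = substVar v s

_[_] : Tm Δ A → Sub Γ Δ → Tm Γ A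
var v [ s ]     = substVar v s
lam t [ s ]     = lam (t [ wkSub (drop idOPE) s , var ze ])
app t u [ s ]   = app (t [ s ]) (u [ s ])
box t [ s ]     = box (t [ lock s nil ])
unbox t e [ s ] with factorSub e s
... | _ , s' , e' = unbox (t [ s' ]) e'

infix 4 _≈_
data _≈_ : Tm Γ A → Tm Γ A → Set where
  ≈-refl  : {t : Tm Γ A} → t ≈ t
  ≈-sym   : {t t' : Tm Γ A} → t ≈ t' → t' ≈ t
  ≈-trans : {t t' t'' : Tm Γ A} → t ≈ t' → t' ≈ t'' → t ≈ t''
  ⇒-β     : {t : Tm (Γ `, A) B} {u : Tm Γ A} → app (lam t) u ≈ t [ idSub , u ]
  ⇒-η     : {t : Tm Γ (A ⇒ B)} → t ≈ lam (app (wk (drop idOPE) t) (var ze))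
  □-β     : {t : Tm (Δ ,🔒) A} {e : Δ ◁ Γ} → unbox (box t) e ≈ wk (factor e) t
  □-η     : {t : Tm Γ (□ A)} → t ≈ box (unbox t nil)
  cong-lam   : {t t' : Tm (Γ `, A) B} → t ≈ t' → lam t ≈ lam t'
  cong-app   : {t t' : Tm Γ (A ⇒ B)} {u u' : Tm Γ A} → t ≈ t' → u ≈ u' → app t u ≈ app t' u'
  cong-box   : {t t' : Tm (Γ ,🔒) A} → t ≈ t' → box t ≈ box t'
  cong-unbox : {t t' : Tm Δ (□ A)} {e : Δ ◁ Γ} → t ≈ t' → unbox t e ≈ unbox t' e

data Ne : Ctx → Ty → Set
data Nf : Ctx → Ty → Set

data Ne where
  var   : Var Γ A → Ne Γ A
  app   : Ne Γ (A ⇒ B) → Nf Γ A → Ne Γ B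
  unbox : Ne Δ (□ A) → Δ ◁ Γ → Ne Γ A

data Nf where
  up  : Ne Γ ι → Nf Γ ι
  lam : Nf (Γ `, A) B → Nf Γ (A ⇒ B)
  box : Nf (Γ ,🔒) A → Nf Γ (□ A)

embNe : Ne Γ A → Tm Γ A
embNf : Nf Γ A → Tm Γ A
embNe (var v)     = var v
embNe (app n m)   = app (embNe n) (embNf m)
embNe (unbox n e) = unbox (embNe n) e
embNf (up n)  = embNe n
embNf (lam m) = lam (embNf m)
embNf (box m) = box (embNf m)

wkNe : Γ ≤ Γ' → Ne Γ A → Ne Γ' A
wkNf : Γ ≤ Γ' → Nf Γ A → Nf Γ' A
wkNe o (var v)     = var (wkVar o v)
wkNe o (app n m)   = app (wkNe o n) (wkNf o m)
wkNe o (unbox n e) with ◁-wk e o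
... | _ , o' , e' = unbox (wkNe o' n) e'
wkNf o (up n)  = up (wkNe o n)
wkNf o (lam m) = lam (wkNf (keep o) m)
wkNf o (box m) = box (wkNf (keep🔒 o) m)

⟦_⟧ : Ty → Ctx → Set
⟦ ι ⟧     Γ = Ne Γ ι
⟦ A ⇒ B ⟧ Γ = ∀ {Γ'} → Γ ≤ Γ' → ⟦ A ⟧ Γ' → ⟦ B ⟧ Γ'
⟦ □ A ⟧   Γ = ∀ {Γ'} → Γ ≤ Γ' → ∀ {Δ} → Γ' ◁ Δ → ⟦ A ⟧ Δ

⟦_⟧c : Ctx → Ctx → Set
⟦ [] ⟧c     w = ⊤
⟦ Γ `, A ⟧c w = ⟦ Γ ⟧c w × ⟦ A ⟧ w
⟦ Γ ,🔒 ⟧c  w = Σ Ctx (λ u → ⟦ Γ ⟧c u × (u ◁ w))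

wkVal : ∀ A → w ≤ w' → ⟦ A ⟧ w → ⟦ A ⟧ w'
wkVal ι       o n = wkNe o n
wkVal (A ⇒ B) o f = λ o' a → f (o ∙ o') a
wkVal (□ A)   o b = λ o' e → b (o ∙ o') e

wkEnv : ∀ Γ → w ≤ w' → ⟦ Γ ⟧c w → ⟦ Γ ⟧c w'
wkEnv []       o tt      = tt
wkEnv (Γ `, A) o (δ , a) = wkEnv Γ o δ , wkVal A o a
wkEnv (Γ ,🔒)  o (u , δ , e) with ◁-wk e o
... | u' , o' , e' = u' , wkEnv Γ o' δ , e'

lookupV : Var Γ A → ⟦ Γ ⟧c w → ⟦ A ⟧ w
lookupV ze     (δ , a) = a
lookupV (su v) (δ , a) = lookupV v δ

factorEnv : Δ ◁ Γ → ⟦ Γ ⟧c w → Σ Ctx (λ u → ⟦ Δ ⟧c u × (u ◁ w))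
factorEnv nil     (u , δ , e) = u , δ , e
factorEnv (ext e) (δ , a)     = factorEnv e δ

eval : Tm Γ A → ⟦ Γ ⟧c w → ⟦ A ⟧ w
eval (var v)            δ = lookupV v δ
eval {Γ = Γ} (lam t)    δ = λ o a → eval t (wkEnv Γ o δ , a)
eval (app t u)          δ = eval t δ idOPE (eval u δ)
eval {Γ = Γ} (box t) δ = λ o e → eval t (_ , wkEnv Γ o δ , e)
eval (unbox t e)        δ with factorEnv e δ
... | u , δ' , e' = eval t δ' idOPE e'

R : ∀ A Γ → Tm Γ A → ⟦ A ⟧ Γ → Set
R ι       Γ t n = t ≈ embNe n
R (A ⇒ B) Γ t f = ∀ {Γ'} (o : Γ ≤ Γ') (u : Tm Γ' A) (a : ⟦ A ⟧ Γ') →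
                  R A Γ' u a → R B Γ' (app (wk o t) u) (f o a)
R (□ A)   Γ t b = ∀ {Γ'} (o : Γ ≤ Γ') {Δ} (e : Γ' ◁ Δ) →
                  R A Δ (unbox (wk o t) e) (b o e)

data Rs : ∀ Δ Γ → Sub Γ Δ → ⟦ Δ ⟧c Γ → Set where
  emptyR : Rs [] Γ empty tt
  extR   : {s : Sub Γ Δ} {δ : ⟦ Δ ⟧c Γ} {t : Tm Γ A} {a : ⟦ A ⟧ Γ} →
           Rs Δ Γ s δ → R A Γ t a → Rs (Δ `, A) Γ (s , t) (δ , a)
  lockR  : {s : Sub Θ Δ} {δ : ⟦ Δ ⟧c Θ} {e : Θ ◁ Γ} →
           Rs Δ Θ s δ → Rs (Δ ,🔒) Γ (lock s e) (Θ , δ , e)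

{-# OPTIONS --safe #-}
-- Two facts about the logical relation carry the induction:
-- it is closed under ≈ (so β-reducts may replace redexes) and monotone along OPEs
-- (so the relation between s and δ survives the weakenings that λ and box perform).
-- What remains are syntactic equations identifying the substituted β-reducts, which
-- follow from the functoriality of weakening and the associativity and unit laws of
-- substitution, including the factorisations through locks.
module Submission where

open import Data.Product using (Σ; _×_; _,_; proj₁; proj₂)
open import Relation.Binary.PropositionalEquality
  using (_≡_; refl; sym; trans; cong; cong₂; subst; module ≡-Reasoning)

open import Defs

open ≡-Reasoning

≡⇒≈ : {t t' : Tm Γ A} → t ≡ t' → t ≈ t'
≡⇒≈ refl = ≈-refl

∙-identityˡ : (o : Γ ≤ Γ') → idOPE ∙ o ≡ o
∙-identityˡ base       = refl
∙-identityˡ (drop o)   = cong drop (∙-identityˡ o)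
∙-identityˡ (keep o)   = cong keep (∙-identityˡ o)
∙-identityˡ (keep🔒 o) = cong keep🔒 (∙-identityˡ o)

∙-identityʳ : (o : Γ ≤ Γ') → o ∙ idOPE ≡ o
∙-identityʳ base       = refl
∙-identityʳ (drop o)   = cong drop (∙-identityʳ o)
∙-identityʳ (keep o)   = cong keep (∙-identityʳ o)
∙-identityʳ (keep🔒 o) = cong keep🔒 (∙-identityʳ o)

idOPE-∙-comm : (o : Γ ≤ Γ') → idOPE ∙ o ≡ o ∙ idOPE
idOPE-∙-comm o = trans (∙-identityˡ o) (sym (∙-identityʳ o))

lCtx : Δ ◁ Γ → Γ ≤ Γ' → Ctx
lCtx e o = proj₁ (◁-wk e o)

factorWk : (e : Δ ◁ Γ) (o : Γ ≤ Γ') → Δ ≤ lCtx e o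
factorWk e o = proj₁ (proj₂ (◁-wk e o))

factor◁ : (e : Δ ◁ Γ) (o : Γ ≤ Γ') → lCtx e o ◁ Γ'
factor◁ e o = proj₂ (proj₂ (◁-wk e o))

extWk : Σ Ctx (λ Δ' → (Δ ≤ Δ') × (Δ' ◁ Γ)) → Σ Ctx (λ Δ' → (Δ ≤ Δ') × (Δ' ◁ (Γ `, A)))
extWk (Δ' , o , e) = Δ' , o , ext e

◁-wk-id : (e : Δ ◁ Γ) → ◁-wk e idOPE ≡ (Δ , idOPE , e)
◁-wk-id nil     = refl
◁-wk-id (ext e) = cong extWk (◁-wk-id e)

◁-wk-∙ : (e : Δ ◁ Γ) (o : Γ ≤ Γ') (o' : Γ' ≤ Γ'') →
  ◁-wk e (o ∙ o') ≡ (lCtx (factor◁ e o) o' , factorWk e o ∙ factorWk (factor◁ e o) o' , factor◁ (factor◁ e o) o')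
◁-wk-∙ e       o          (drop o')   = cong extWk (◁-wk-∙ e o o')
◁-wk-∙ e       (drop o)   (keep o')   = cong extWk (◁-wk-∙ e o o')
◁-wk-∙ (ext e) (keep o)   (keep o')   = cong extWk (◁-wk-∙ e o o')
◁-wk-∙ nil     (keep🔒 o) (keep🔒 o') = refl
◁-wk-∙ ()      base       base

◁-wk-factor : (e : Δ ◁ Γ) → ◁-wk nil (factor e) ≡ (Δ , idOPE , e)
◁-wk-factor nil     = refl
◁-wk-factor (ext e) = cong extWk (◁-wk-factor e)

factor-natural : (e : Δ ◁ Γ) (o : Γ ≤ Γ') → factor e ∙ o ≡ keep🔒 (factorWk e o) ∙ factor (factor◁ e o)
factor-natural e       (drop o)   = cong drop (factor-natural e o)
factor-natural (ext e) (keep o)   = cong drop (factor-natural e o)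
factor-natural nil     (keep🔒 o) = cong keep🔒 (idOPE-∙-comm o)

wkVar-id : (v : Var Γ A) → wkVar idOPE v ≡ v
wkVar-id ze     = refl
wkVar-id (su v) = cong su (wkVar-id v)

wkVar-∙ : (o : Γ ≤ Γ') (o' : Γ' ≤ Γ'') (v : Var Γ A) → wkVar o' (wkVar o v) ≡ wkVar (o ∙ o') v
wkVar-∙ o          (drop o')   v      = cong su (wkVar-∙ o o' v)
wkVar-∙ (drop o)   (keep o')   v      = cong su (wkVar-∙ o o' v)
wkVar-∙ (keep o)   (keep o')   ze     = refl
wkVar-∙ (keep o)   (keep o')   (su v) = cong su (wkVar-∙ o o' v)
wkVar-∙ base       base        ()
wkVar-∙ (keep🔒 o) (keep🔒 o') ()

wk-id : (t : Tm Γ A) → wk idOPE t ≡ t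
wk-id (var v)     = cong var (wkVar-id v)
wk-id (lam t)     = cong lam (wk-id t)
wk-id (app t u)   = cong₂ app (wk-id t) (wk-id u)
wk-id (box t)     = cong box (wk-id t)
wk-id (unbox t e) rewrite ◁-wk-id e = cong (λ t' → unbox t' e) (wk-id t)

wk-∙ : (o : Γ ≤ Γ') (o' : Γ' ≤ Γ'') (t : Tm Γ A) → wk o' (wk o t) ≡ wk (o ∙ o') t
wk-∙ o o' (var v)     = cong var (wkVar-∙ o o' v)
wk-∙ o o' (lam t)     = cong lam (wk-∙ (keep o) (keep o') t)
wk-∙ o o' (app t u)   = cong₂ app (wk-∙ o o' t) (wk-∙ o o' u)
wk-∙ o o' (box t)     = cong box (wk-∙ (keep🔒 o) (keep🔒 o') t)
wk-∙ o o' (unbox t e) rewrite ◁-wk-∙ e o o' =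
  cong (λ t' → unbox t' (factor◁ (factor◁ e o) o')) (wk-∙ (factorWk e o) (factorWk (factor◁ e o) o') t)

wkSub-id : (s : Sub Γ Δ) → wkSub idOPE s ≡ s
wkSub-id empty      = refl
wkSub-id (s , t)    = cong₂ _,_ (wkSub-id s) (wk-id t)
wkSub-id (lock s e) rewrite ◁-wk-id e = cong (λ s' → lock s' e) (wkSub-id s)

wkSub-∙ : (o : Γ ≤ Γ') (o' : Γ' ≤ Γ'') (s : Sub Γ Δ) → wkSub o' (wkSub o s) ≡ wkSub (o ∙ o') s
wkSub-∙ o o' empty      = refl
wkSub-∙ o o' (s , t)    = cong₂ _,_ (wkSub-∙ o o' s) (wk-∙ o o' t)
wkSub-∙ o o' (lock s e) rewrite ◁-wk-∙ e o o' =
  cong (λ s' → lock s' (factor◁ (factor◁ e o) o')) (wkSub-∙ (factorWk e o) (factorWk (factor◁ e o) o') s)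

wkSub-keep-drop : (o : Γ ≤ Γ') (s : Sub Γ Δ) →
  wkSub (keep {A = A} o) (wkSub (drop idOPE) s) ≡ wkSub (drop idOPE) (wkSub o s)
wkSub-keep-drop o s = begin
  wkSub (keep o) (wkSub (drop idOPE) s) ≡⟨ wkSub-∙ (drop idOPE) (keep o) s ⟩
  wkSub (drop (idOPE ∙ o)) s            ≡⟨ cong (λ o' → wkSub (drop o') s) (idOPE-∙-comm o) ⟩
  wkSub (o ∙ drop idOPE) s              ≡⟨ wkSub-∙ o (drop idOPE) s ⟨
  wkSub (drop idOPE) (wkSub o s)        ∎

wkSub-factor-lock : (e : Δ ◁ Γ) (s : Sub Δ Θ) → wkSub (factor e) (lock s nil) ≡ lock s e
wkSub-factor-lock e s rewrite ◁-wk-factor e = cong (λ s' → lock s' e) (wkSub-id s)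

lCtxₛ : Δ' ◁ Δ → Sub Γ Δ → Ctx
lCtxₛ e s = proj₁ (factorSub e s)

factorSubₛ : (e : Δ' ◁ Δ) (s : Sub Γ Δ) → Sub (lCtxₛ e s) Δ'
factorSubₛ e s = proj₁ (proj₂ (factorSub e s))

factor◁ₛ : (e : Δ' ◁ Δ) (s : Sub Γ Δ) → lCtxₛ e s ◁ Γ
factor◁ₛ e s = proj₂ (proj₂ (factorSub e s))

factorSub-wkSub : (e : Δ' ◁ Δ) (s : Sub Γ Δ) (o : Γ ≤ Γ') →
  factorSub e (wkSub o s) ≡ (lCtx (factor◁ₛ e s) o , wkSub (factorWk (factor◁ₛ e s) o) (factorSubₛ e s) , factor◁ (factor◁ₛ e s) o)
factorSub-wkSub nil     (lock s e) o = refl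
factorSub-wkSub (ext e) (s , t)    o = factorSub-wkSub e s o

substVar-wkSub : (v : Var Δ A) (s : Sub Γ Δ) (o : Γ ≤ Γ') → substVar v (wkSub o s) ≡ wk o (substVar v s)
substVar-wkSub ze     (s , t) o = refl
substVar-wkSub (su v) (s , t) o = substVar-wkSub v s o

wk-[] : (t : Tm Δ A) (s : Sub Γ Δ) (o : Γ ≤ Γ') → wk o (t [ s ]) ≡ t [ wkSub o s ]
wk-[] (var v)   s o = sym (substVar-wkSub v s o)
wk-[] (lam t)   s o =
  cong lam (trans (wk-[] t _ (keep o)) (cong (λ s' → t [ s' , var ze ]) (wkSub-keep-drop o s)))
wk-[] (app t u) s o = cong₂ app (wk-[] t s o) (wk-[] u s o)
wk-[] (box t)   s o = cong box (wk-[] t (lock s nil) (keep🔒 o))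
wk-[] (unbox t e) s o rewrite factorSub-wkSub e s o =
  cong (λ t' → unbox t' (factor◁ (factor◁ₛ e s) o)) (wk-[] t (factorSubₛ e s) (factorWk (factor◁ₛ e s) o))

_⊙_ : Δ ≤ Δ' → Sub Γ Δ' → Sub Γ Δ
base     ⊙ empty    = empty
drop o   ⊙ (s , t)  = o ⊙ s
keep o   ⊙ (s , t)  = (o ⊙ s) , t
keep🔒 o ⊙ lock s e = lock (o ⊙ s) e

idOPE-⊙ : (s : Sub Γ Δ) → idOPE ⊙ s ≡ s
idOPE-⊙ empty      = refl
idOPE-⊙ (s , t)    = cong (_, t) (idOPE-⊙ s)
idOPE-⊙ (lock s e) = cong (λ s' → lock s' e) (idOPE-⊙ s)

substVar-wkVar : (v : Var Δ A) (o : Δ ≤ Δ') (s : Sub Γ Δ') → substVar (wkVar o v) s ≡ substVar v (o ⊙ s)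
substVar-wkVar v      (drop o) (s , t) = substVar-wkVar v o s
substVar-wkVar ze     (keep o) (s , t) = refl
substVar-wkVar (su v) (keep o) (s , t) = substVar-wkVar v o s

⊙-wkSub : (o : Δ ≤ Δ') (s : Sub Γ Δ') (o' : Γ ≤ Γ') → o ⊙ wkSub o' s ≡ wkSub o' (o ⊙ s)
⊙-wkSub base       empty      o' = refl
⊙-wkSub (drop o)   (s , t)    o' = ⊙-wkSub o s o'
⊙-wkSub (keep o)   (s , t)    o' = cong (_, wk o' t) (⊙-wkSub o s o')
⊙-wkSub (keep🔒 o) (lock s e) o' = cong (λ s' → lock s' (factor◁ e o')) (⊙-wkSub o s (factorWk e o'))

factorSub-⊙ : (e : Θ ◁ Δ) (o : Δ ≤ Δ') (s : Sub Γ Δ') →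
  factorSub e (o ⊙ s) ≡ (lCtxₛ (factor◁ e o) s , factorWk e o ⊙ factorSubₛ (factor◁ e o) s , factor◁ₛ (factor◁ e o) s)
factorSub-⊙ e       (drop o)   (s , t)    = factorSub-⊙ e o s
factorSub-⊙ (ext e) (keep o)   (s , t)    = factorSub-⊙ e o s
factorSub-⊙ nil     (keep🔒 o) (lock s e) = refl

[]-wk : (t : Tm Δ A) (o : Δ ≤ Δ') (s : Sub Γ Δ') → wk o t [ s ] ≡ t [ o ⊙ s ]
[]-wk (var v)   o s = substVar-wkVar v o s
[]-wk (lam t)   o s =
  cong lam (trans ([]-wk t (keep o) _) (cong (λ s' → t [ s' , var ze ]) (⊙-wkSub o s (drop idOPE))))
[]-wk (app t u) o s = cong₂ app ([]-wk t o s) ([]-wk u o s)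
[]-wk (box t)   o s = cong box ([]-wk t (keep🔒 o) (lock s nil))
[]-wk (unbox t e) o s rewrite factorSub-⊙ e o s =
  cong (λ t' → unbox t' (factor◁ₛ (factor◁ e o) s)) ([]-wk t (factorWk e o) (factorSubₛ (factor◁ e o) s))

_⊚_ : Sub Θ Δ → Sub Γ Θ → Sub Γ Δ
empty    ⊚ s' = empty
(s , t)  ⊚ s' = (s ⊚ s') , (t [ s' ])
lock s e ⊚ s' = lock (s ⊚ factorSubₛ e s') (factor◁ₛ e s')

factorSub-⊚ : (e : Δ' ◁ Δ) (s : Sub Θ Δ) (s' : Sub Γ Θ) →
  factorSub e (s ⊚ s') ≡ (lCtxₛ (factor◁ₛ e s) s' , factorSubₛ e s ⊚ factorSubₛ (factor◁ₛ e s) s' , factor◁ₛ (factor◁ₛ e s) s')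
factorSub-⊚ nil     (lock s e) s' = refl
factorSub-⊚ (ext e) (s , t)    s' = factorSub-⊚ e s s'

substVar-⊚ : (v : Var Δ A) (s : Sub Θ Δ) (s' : Sub Γ Θ) → substVar v s [ s' ] ≡ substVar v (s ⊚ s')
substVar-⊚ ze     (s , t) s' = refl
substVar-⊚ (su v) (s , t) s' = substVar-⊚ v s s'

wkSub-⊚ : (s : Sub Θ Δ) (o : Θ ≤ Δ') (s' : Sub Γ Δ') → wkSub o s ⊚ s' ≡ s ⊚ (o ⊙ s')
wkSub-⊚ empty      o s' = refl
wkSub-⊚ (s , t)    o s' = cong₂ _,_ (wkSub-⊚ s o s') ([]-wk t o s')
wkSub-⊚ (lock s e) o s' rewrite factorSub-⊙ e o s' =
  cong (λ s'' → lock s'' (factor◁ₛ (factor◁ e o) s')) (wkSub-⊚ s (factorWk e o) (factorSubₛ (factor◁ e o) s'))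

⊚-wkSub : (s : Sub Θ Δ) (s' : Sub Γ Θ) (o : Γ ≤ Γ') → s ⊚ wkSub o s' ≡ wkSub o (s ⊚ s')
⊚-wkSub empty      s' o = refl
⊚-wkSub (s , t)    s' o = cong₂ _,_ (⊚-wkSub s s' o) (sym (wk-[] t s' o))
⊚-wkSub (lock s e) s' o rewrite factorSub-wkSub e s' o =
  cong (λ s'' → lock s'' (factor◁ (factor◁ₛ e s') o)) (⊚-wkSub s (factorSubₛ e s') (factorWk (factor◁ₛ e s') o))

[]-⊚ : (t : Tm Δ A) (s : Sub Θ Δ) (s' : Sub Γ Θ) → t [ s ] [ s' ] ≡ t [ s ⊚ s' ]
[]-⊚ (var v)   s s' = substVar-⊚ v s s'
[]-⊚ (lam t)   s s' = cong lam (trans ([]-⊚ t _ _) (cong (λ s'' → t [ s'' , var ze ]) lifted))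
  where
  lifted : wkSub (drop idOPE) s ⊚ (wkSub (drop idOPE) s' , var ze) ≡ wkSub (drop idOPE) (s ⊚ s')
  lifted = begin
    wkSub (drop idOPE) s ⊚ (wkSub (drop idOPE) s' , var ze) ≡⟨ wkSub-⊚ s (drop idOPE) _ ⟩
    s ⊚ (idOPE ⊙ wkSub (drop idOPE) s')                      ≡⟨ cong (s ⊚_) (idOPE-⊙ _) ⟩
    s ⊚ wkSub (drop idOPE) s'                                ≡⟨ ⊚-wkSub s s' (drop idOPE) ⟩
    wkSub (drop idOPE) (s ⊚ s')                              ∎
[]-⊚ (app t u) s s' = cong₂ app ([]-⊚ t s s') ([]-⊚ u s s')
[]-⊚ (box t)   s s' = cong box ([]-⊚ t (lock s nil) (lock s' nil))
[]-⊚ (unbox t e) s s' rewrite factorSub-⊚ e s s' =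
  cong (λ t' → unbox t' (factor◁ₛ (factor◁ₛ e s) s')) ([]-⊚ t (factorSubₛ e s) (factorSubₛ (factor◁ₛ e s) s'))

substVar-idSub : (v : Var Γ A) → substVar v idSub ≡ var v
substVar-idSub ze     = refl
substVar-idSub (su v) = begin
  substVar v (wkSub (drop idOPE) idSub) ≡⟨ substVar-wkSub v idSub (drop idOPE) ⟩
  wk (drop idOPE) (substVar v idSub)    ≡⟨ cong (wk (drop idOPE)) (substVar-idSub v) ⟩
  var (su (wkVar idOPE v))              ≡⟨ cong (λ v' → var (su v')) (wkVar-id v) ⟩
  var (su v)                            ∎

factorSub-idSub : (e : Δ ◁ Γ) → factorSub e idSub ≡ (Δ , idSub , e)
factorSub-idSub nil = refl
factorSub-idSub {Δ} {Γ `, A} (ext e)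
  rewrite factorSub-wkSub e idSub (drop {A = A} idOPE) | factorSub-idSub e | ◁-wk-id e =
  cong (λ s → Δ , s , ext e) (wkSub-id idSub)

[]-idSub : (t : Tm Γ A) → t [ idSub ] ≡ t
[]-idSub (var v)     = substVar-idSub v
[]-idSub (lam t)     = cong lam ([]-idSub t)
[]-idSub (app t u)   = cong₂ app ([]-idSub t) ([]-idSub u)
[]-idSub (box t)     = cong box ([]-idSub t)
[]-idSub (unbox t e) rewrite factorSub-idSub e = cong (λ t' → unbox t' e) ([]-idSub t)

⊚-idSub : (s : Sub Γ Δ) → s ⊚ idSub ≡ s
⊚-idSub empty      = refl
⊚-idSub (s , t)    = cong₂ _,_ (⊚-idSub s) ([]-idSub t)
⊚-idSub (lock s e) rewrite factorSub-idSub e = cong (λ s' → lock s' e) (⊚-idSub s)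

⊙-idSub : (o : Δ ≤ Γ) → o ⊙ idSub ≡ wkSub o idSub
⊙-idSub base       = refl
⊙-idSub (drop o)   = begin
  o ⊙ wkSub (drop idOPE) idSub       ≡⟨ ⊙-wkSub o idSub (drop idOPE) ⟩
  wkSub (drop idOPE) (o ⊙ idSub)     ≡⟨ cong (wkSub (drop idOPE)) (⊙-idSub o) ⟩
  wkSub (drop idOPE) (wkSub o idSub) ≡⟨ wkSub-∙ o (drop idOPE) idSub ⟩
  wkSub (drop (o ∙ idOPE)) idSub     ≡⟨ cong (λ o' → wkSub (drop o') idSub) (∙-identityʳ o) ⟩
  wkSub (drop o) idSub               ∎
⊙-idSub (keep o)   = cong (_, var ze) (begin
  o ⊙ wkSub (drop idOPE) idSub              ≡⟨ ⊙-idSub (drop o) ⟩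
  wkSub (drop o) idSub                      ≡⟨ cong (λ o' → wkSub (drop o') idSub) (∙-identityˡ o) ⟨
  wkSub (drop (idOPE ∙ o)) idSub            ≡⟨ wkSub-∙ (drop idOPE) (keep o) idSub ⟨
  wkSub (keep o) (wkSub (drop idOPE) idSub) ∎)
⊙-idSub (keep🔒 o) = cong (λ s → lock s nil) (⊙-idSub o)

wk-≈ : {t t' : Tm Γ A} (o : Γ ≤ Γ') → t ≈ t' → wk o t ≈ wk o t'
wk-≈ o ≈-refl        = ≈-refl
wk-≈ o (≈-sym p)     = ≈-sym (wk-≈ o p)
wk-≈ o (≈-trans p q) = ≈-trans (wk-≈ o p) (wk-≈ o q)
wk-≈ o (⇒-β {t = t} {u = u}) = ≈-trans ⇒-β (≡⇒≈ (begin
  wk (keep o) t [ idSub , wk o u ] ≡⟨ []-wk t (keep o) (idSub , wk o u) ⟩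
  t [ (o ⊙ idSub) , wk o u ]       ≡⟨ cong (λ s → t [ s , wk o u ]) (⊙-idSub o) ⟩
  t [ wkSub o (idSub , u) ]        ≡⟨ wk-[] t (idSub , u) o ⟨
  wk o (t [ idSub , u ])           ∎))
wk-≈ o (⇒-η {t = t}) = ≈-trans ⇒-η (≡⇒≈ (cong (λ t' → lam (app t' (var ze))) (begin
  wk (drop idOPE) (wk o t)        ≡⟨ wk-∙ o (drop idOPE) t ⟩
  wk (drop (o ∙ idOPE)) t         ≡⟨ cong (λ o' → wk (drop o') t) (idOPE-∙-comm o) ⟨
  wk (drop (idOPE ∙ o)) t         ≡⟨ wk-∙ (drop idOPE) (keep o) t ⟨
  wk (keep o) (wk (drop idOPE) t) ∎)))
wk-≈ o (□-β {t = t} {e = e}) = ≈-trans □-β (≡⇒≈ (begin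
  wk (factor (factor◁ e o)) (wk (keep🔒 (factorWk e o)) t) ≡⟨ wk-∙ _ _ t ⟩
  wk (keep🔒 (factorWk e o) ∙ factor (factor◁ e o)) t     ≡⟨ cong (λ o' → wk o' t) (factor-natural e o) ⟨
  wk (factor e ∙ o) t                                       ≡⟨ wk-∙ (factor e) o t ⟨
  wk o (wk (factor e) t)                                    ∎))
wk-≈ o □-η                    = □-η
wk-≈ o (cong-lam p)           = cong-lam (wk-≈ (keep o) p)
wk-≈ o (cong-app p q)         = cong-app (wk-≈ o p) (wk-≈ o q)
wk-≈ o (cong-box p)           = cong-box (wk-≈ (keep🔒 o) p)
wk-≈ o (cong-unbox {e = e} p) = cong-unbox (wk-≈ (factorWk e o) p)

wk-embNe : (o : Γ ≤ Γ') (n : Ne Γ A) → wk o (embNe n) ≡ embNe (wkNe o n)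
wk-embNf : (o : Γ ≤ Γ') (m : Nf Γ A) → wk o (embNf m) ≡ embNf (wkNf o m)
wk-embNe o (var v)     = refl
wk-embNe o (app n m)   = cong₂ app (wk-embNe o n) (wk-embNf o m)
wk-embNe o (unbox n e) = cong (λ t → unbox t (factor◁ e o)) (wk-embNe (factorWk e o) n)
wk-embNf o (up n)      = wk-embNe o n
wk-embNf o (lam m)     = cong lam (wk-embNf (keep o) m)
wk-embNf o (box m)     = cong box (wk-embNf (keep🔒 o) m)

R-≈ : ∀ A {t t' : Tm Γ A} {a : ⟦ A ⟧ Γ} → t ≈ t' → R A Γ t a → R A Γ t' a
R-≈ ι       p r = ≈-trans (≈-sym p) r
R-≈ (A ⇒ B) p r = λ o u a ra → R-≈ B (cong-app (wk-≈ o p) ≈-refl) (r o u a ra)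
R-≈ (□ A)   p r = λ o e → R-≈ A (cong-unbox (wk-≈ o p)) (r o e)

R-wk : ∀ A (o : Γ ≤ Γ') {t : Tm Γ A} {a : ⟦ A ⟧ Γ} → R A Γ t a → R A Γ' (wk o t) (wkVal A o a)
R-wk ι       o {t} {n} r = subst (wk o t ≈_) (wk-embNe o n) (wk-≈ o r)
R-wk (A ⇒ B) o {t} {f} r = λ o' u a ra →
  subst (λ t' → R B _ (app t' u) (f (o ∙ o') a)) (sym (wk-∙ o o' t)) (r (o ∙ o') u a ra)
R-wk (□ A)   o {t} {b} r = λ o' e →
  subst (λ t' → R A _ (unbox t' e) (b (o ∙ o') e)) (sym (wk-∙ o o' t)) (r (o ∙ o') e)

Rs-wk : {s : Sub Γ Δ} {δ : ⟦ Δ ⟧c Γ} (o : Γ ≤ Γ') → Rs Δ Γ s δ → Rs Δ Γ' (wkSub o s) (wkEnv Δ o δ)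
Rs-wk o emptyR               = emptyR
Rs-wk o (extR {A = A} rs ra) = extR (Rs-wk o rs) (R-wk A o ra)
Rs-wk o (lockR {e = e} rs)   = lockR (Rs-wk (factorWk e o) rs)

Rs-lookup : {s : Sub Γ Δ} {δ : ⟦ Δ ⟧c Γ} → Rs Δ Γ s δ → (v : Var Δ A) → R A Γ (substVar v s) (lookupV v δ)
Rs-lookup (extR rs ra) ze     = ra
Rs-lookup (extR rs ra) (su v) = Rs-lookup rs v

-- An inductive family, so that matching on it identifies the lock context and the
-- accessibility witness of the two factorisations.
data FactorR {Δ Γ : Ctx} : Σ Ctx (λ Θ → Sub Θ Δ × (Θ ◁ Γ)) → Σ Ctx (λ u → ⟦ Δ ⟧c u × (u ◁ Γ)) → Set where
  factorR : {s : Sub Θ Δ} {δ : ⟦ Δ ⟧c Θ} {e : Θ ◁ Γ} → Rs Δ Θ s δ → FactorR (Θ , s , e) (Θ , δ , e)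

Rs-factor : {s : Sub Γ Δ} {δ : ⟦ Δ ⟧c Γ} (e : Δ' ◁ Δ) → Rs Δ Γ s δ → FactorR (factorSub e s) (factorEnv e δ)
Rs-factor nil     (lockR rs)   = factorR rs
Rs-factor (ext e) (extR rs ra) = Rs-factor e rs

lam-[]-β : (t : Tm (Δ `, A) B) (s : Sub Γ Δ) (o : Γ ≤ Γ') (u : Tm Γ' A) →
  wk (keep o) (t [ wkSub (drop idOPE) s , var ze ]) [ idSub , u ] ≡ t [ wkSub o s , u ]
lam-[]-β t s o u = begin
  wk (keep o) (t [ wkSub (drop idOPE) s , var ze ]) [ idSub , u ]
    ≡⟨ cong (_[ idSub , u ]) (wk-[] t _ (keep o)) ⟩
  t [ wkSub (keep o) (wkSub (drop idOPE) s) , var ze ] [ idSub , u ]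
    ≡⟨ []-⊚ t _ _ ⟩
  t [ wkSub (keep o) (wkSub (drop idOPE) s) ⊚ (idSub , u) , u ]
    ≡⟨ cong (λ s' → t [ s' ⊚ (idSub , u) , u ]) (wkSub-∙ (drop idOPE) (keep o) s) ⟩
  t [ wkSub (drop (idOPE ∙ o)) s ⊚ (idSub , u) , u ]
    ≡⟨ cong (λ o' → t [ wkSub (drop o') s ⊚ (idSub , u) , u ]) (∙-identityˡ o) ⟩
  t [ wkSub (drop o) s ⊚ (idSub , u) , u ]
    ≡⟨ cong (λ s' → t [ s' , u ]) (wkSub-⊚ s (drop o) (idSub , u)) ⟩
  t [ s ⊚ (o ⊙ idSub) , u ]
    ≡⟨ cong (λ s' → t [ s ⊚ s' , u ]) (⊙-idSub o) ⟩
  t [ s ⊚ wkSub o idSub , u ]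
    ≡⟨ cong (λ s' → t [ s' , u ]) (⊚-wkSub s idSub o) ⟩
  t [ wkSub o (s ⊚ idSub) , u ]
    ≡⟨ cong (λ s' → t [ wkSub o s' , u ]) (⊚-idSub s) ⟩
  t [ wkSub o s , u ] ∎

box-[]-β : (t : Tm (Δ ,🔒) A) (s : Sub Γ Δ) (o : Γ ≤ Γ') (e : Γ' ◁ Θ) →
  wk (factor e) (wk (keep🔒 o) (t [ lock s nil ])) ≡ t [ lock (wkSub o s) e ]
box-[]-β t s o e = begin
  wk (factor e) (wk (keep🔒 o) (t [ lock s nil ])) ≡⟨ cong (wk (factor e)) (wk-[] t (lock s nil) (keep🔒 o)) ⟩
  wk (factor e) (t [ lock (wkSub o s) nil ])       ≡⟨ wk-[] t _ (factor e) ⟩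
  t [ wkSub (factor e) (lock (wkSub o s) nil) ]    ≡⟨ cong (t [_]) (wkSub-factor-lock e _) ⟩
  t [ lock (wkSub o s) e ]                         ∎

proposition3p5 : ∀ {Δ Γ A} (t : Tm Δ A) (s : Sub Γ Δ) (δ : ⟦ Δ ⟧c Γ) →
    Rs Δ Γ s δ → R A Γ (t [ s ]) (eval t δ)
proposition3p5 (var v) s δ rs = Rs-lookup rs v
proposition3p5 {Δ} {A = A ⇒ B} (lam t) s δ rs = λ o u a ra →
  R-≈ B (≈-sym (≈-trans ⇒-β (≡⇒≈ (lam-[]-β t s o u))))
    (proposition3p5 t (wkSub o s , u) (wkEnv Δ o δ , a) (extR (Rs-wk o rs) ra))
proposition3p5 (app t u) s δ rs =
  subst (λ t' → R _ _ (app t' (u [ s ])) _) (wk-id (t [ s ]))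
    (proposition3p5 t s δ rs idOPE (u [ s ]) (eval u δ) (proposition3p5 u s δ rs))
proposition3p5 {Δ} {A = □ A} (box t) s δ rs = λ o e →
  R-≈ A (≈-sym (≈-trans □-β (≡⇒≈ (box-[]-β t s o e))))
    (proposition3p5 t (lock (wkSub o s) e) (_ , wkEnv Δ o δ , e) (lockR (Rs-wk o rs)))
proposition3p5 (unbox t e) s δ rs with factorSub e s | factorEnv e δ | Rs-factor e rs
... | _ | _ | factorR {s = s'} {δ = δ'} {e = e'} rs' =
  subst (λ t' → R _ _ (unbox t' e') _) (wk-id (t [ s' ]))
    (proposition3p5 t s' δ' rs' idOPE e')
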